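{- Let $m\in\mathbb{N}$ and $n\geq 1$. (a) If $D$ is the formal derivative of the grammar $\{x\rightarrow (m-1)x+xy,\ y\rightarrow my\}$, then $D^n(x)=x\sum_{k=0}^n S_m(n,k)\,y^k$. (b) If $D$ is the formal derivative of the grammar $\{x\rightarrow (m-1)x+mxy,\ y\rightarrow my\}$, then $D^n(x)=x\sum_{k=0}^n \overline{S}_m(n,k)\,y^k$. (c) If $D$ is the formal derivative of the grammar $\{x\rightarrow (m-1)x+mxy,\ y\rightarrow m(y+y^2)\}$, then $D^n(x)=x\sum_{k=0}^n \widetilde{S}_m(n,k)\,y^k$.
   Context: The formal derivative of a grammar $\{x\rightarrow f,\ y\rightarrow g\}$ is the unique derivation $D$ (linear, with $D(uv)=D(u)v+uD(v)$) of $\mathbb{Z}[x,y]$ with $D(x)=f$, $D(y)=g$. The Stirling–Frobenius subset numbers $S_m(n,k)$ (Luschny) are given, for $n,k\geq 0$, by $S_m(0,k)=\delta_{k,0}$, $S_m(n,k)=0$ for $k<0$, and $S_m(n,k)=(m(k+1)-1)S_m(n-1,k)+S_m(n-1,k-1)$ for $n\geq 1$. Further, $\overline{S}_m(n,k)=m^k S_m(n,k)$ and $\widetilde{S}_m(n,k)=m^k k!\,S_m(n,k)$; these satisfy $\overline{S}_m(n,k)=(m(k+1)-1)\overline{S}_m(n-1,k)+m\,\overline{S}_m(n-1,k-1)$ and $\widetilde{S}_m(n,k)=(m(k+1)-1)\widetilde{S}_m(n-1,k)+mk\,\widetilde{S}_m(n-1,k-1)$, with the same initial values at $n=0$. -}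

module Defs where

open import Data.Nat as ℕ using (ℕ; zero; suc; _∸_; _!)
open import Data.Integer as ℤ using (ℤ; +_; _+_; _*_; _-_; -_)
open import Relation.Binary.PropositionalEquality using (_≡_)

-- Elements of ℤ[x,y], represented by their coefficient functions:
-- p i j is the coefficient of x^i y^j.  (This representation is that of
-- ℤ[[x,y]] ⊇ ℤ[x,y]; every element occurring in the theorem is a polynomial.)
Poly : Set
Poly = ℕ → ℕ → ℤ

infix 4 _≈_
_≈_ : Poly → Poly → Set
p ≈ q = ∀ i j → p i j ≡ q i j

Σℤ : ℕ → (ℕ → ℤ) → ℤ
Σℤ zero    f = f zero
Σℤ (suc n) f = Σℤ n f + f (suc n)

const : ℤ → Poly
const c zero zero = c
const c _    _    = + 0

X : Poly
X (suc zero) zero = + 1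
X _          _    = + 0

Y : Poly
Y zero (suc zero) = + 1
Y _    _          = + 0

infixl 6 _⊕_
_⊕_ : Poly → Poly → Poly
(p ⊕ q) i j = p i j + q i j

infixl 7 _⊗_
_⊗_ : Poly → Poly → Poly
(p ⊗ q) i j = Σℤ i λ a → Σℤ j λ b → p a b * q (i ∸ a) (j ∸ b)

infixr 8 _^ᵖ_
_^ᵖ_ : Poly → ℕ → Poly
p ^ᵖ zero  = const (+ 1)
p ^ᵖ suc k = p ⊗ (p ^ᵖ k)

Σᵖ : ℕ → (ℕ → Poly) → Poly
Σᵖ zero    f = f zero
Σᵖ (suc n) f = Σᵖ n f ⊕ f (suc n)

∂x : Poly → Poly
∂x p i j = + (suc i) * p (suc i) j

∂y : Poly → Poly
∂y p i j = + (suc j) * p i (suc j)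

-- The formal derivative of the grammar {x → f, y → g}: the unique derivation
-- D of ℤ[x,y] with D x = f, D y = g, namely D p = f ∂p/∂x + g ∂p/∂y.
gramD : Poly → Poly → Poly → Poly
gramD f g p = f ⊗ ∂x p ⊕ g ⊗ ∂y p

iter : ℕ → (Poly → Poly) → Poly → Poly
iter zero    D p = p
iter (suc n) D p = D (iter n D p)

SF : ℕ → ℕ → ℕ → ℤ
SF m zero    zero    = + 1
SF m zero    (suc k) = + 0
SF m (suc n) zero    = (+ m - + 1) * SF m n zero
SF m (suc n) (suc k) = (+ (m ℕ.* (suc k ℕ.+ 1)) - + 1) * SF m n (suc k) + SF m n k

SFbar : ℕ → ℕ → ℕ → ℤ
SFbar m n k = + (m ℕ.^ k) * SF m n k

SFtilde : ℕ → ℕ → ℕ → ℤ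
SFtilde m n k = + (m ℕ.^ k ℕ.* (k !)) * SF m n k

-- Every grammar here has the form x → x(a + e y), y → y(g + t y), and its derivation D maps
-- x·c(y) to x·c̃(y): since D(x y^k) = (a + g k) x y^k + (e + t k) x y^(k+1), we get
-- D^n x = x Σ_k T(n,k) y^k for the triangle T(n+1,k) = (a + g k) T(n,k) + (e + t (k-1)) T(n,k-1).
-- For grammar (a) this is the Stirling–Frobenius recurrence; rescaling row k by m^k, resp. m^k k!,
-- turns it into the triangles of grammars (b) and (c).
module Submission where

open import Defs
open import Data.Nat as ℕ using (ℕ; zero; suc; _≥_; _≤_; _<_; z≤n; s≤s; s≤s⁻¹; _!)
open import Data.Nat.Properties
  using (≤-refl; ≤-<-trans; m<n⇒m<1+n; m≤n⇒m<n∨m≡n; m≤n⇒m≤1+n; <⇒≢; >⇒≢; _≤?_; ≰⇒>)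
open import Data.Integer using (ℤ; +_; _+_; _*_; _-_)
open import Data.Integer.Properties
  using ( +-identityˡ; +-identityʳ; +-assoc; *-identityˡ; *-identityʳ; *-zeroʳ; *-assoc
        ; *-distribˡ-+; *-distribʳ-+; pos-*; pos-+)
open import Data.Integer.Tactic.RingSolver using (solve-∀)
import Data.Nat.Tactic.RingSolver as ℕ-Solver
open import Data.Product using (_×_; _,_)
open import Data.Sum using (inj₁; inj₂)
open import Function using (_∘_)
open import Level using (0ℓ)
open import Relation.Binary.Bundles using (Setoid)
open import Relation.Binary.Structures using (IsEquivalence)
open import Relation.Binary.PropositionalEquality
open import Relation.Nullary using (yes; no; contradiction)
import Relation.Binary.Reasoning.Setoid as SetoidReasoning

Σℤ-cong : ∀ n {f g : ℕ → ℤ} → (∀ a → f a ≡ g a) → Σℤ n f ≡ Σℤ n g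
Σℤ-cong zero    f≗g = f≗g 0
Σℤ-cong (suc n) f≗g = cong₂ _+_ (Σℤ-cong n f≗g) (f≗g (suc n))

Σℤ-zero : ∀ n {f : ℕ → ℤ} → (∀ {a} → a ≤ n → f a ≡ + 0) → Σℤ n f ≡ + 0
Σℤ-zero zero    f≡0 = f≡0 z≤n
Σℤ-zero (suc n) f≡0 = cong₂ _+_ (Σℤ-zero n (f≡0 ∘ m≤n⇒m≤1+n)) (f≡0 ≤-refl)

Σℤ-suc : ∀ n (f : ℕ → ℤ) → Σℤ (suc n) f ≡ f 0 + Σℤ n (f ∘ suc)
Σℤ-suc zero    f = refl
Σℤ-suc (suc n) f = begin
  Σℤ (suc n) f + f (suc (suc n))            ≡⟨ cong (_+ f (suc (suc n))) (Σℤ-suc n f) ⟩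
  f 0 + Σℤ n (f ∘ suc) + f (suc (suc n))    ≡⟨ +-assoc (f 0) _ _ ⟩
  f 0 + Σℤ (suc n) (f ∘ suc)                ∎
  where open ≡-Reasoning

Σℤ-head : ∀ n {f : ℕ → ℤ} → (∀ a → f (suc a) ≡ + 0) → Σℤ n f ≡ f 0
Σℤ-head zero    _     = refl
Σℤ-head (suc n) {f} f≡0 = begin
  Σℤ (suc n) f             ≡⟨ Σℤ-suc n f ⟩
  f 0 + Σℤ n (f ∘ suc)     ≡⟨ cong (_+_ (f 0)) (Σℤ-zero n (λ {a} _ → f≡0 a)) ⟩
  f 0 + + 0                ≡⟨ +-identityʳ (f 0) ⟩
  f 0                      ∎
  where open ≡-Reasoning

Σℤ-single : ∀ n {f : ℕ → ℤ} {k} → k ≤ n → (∀ {a} → a ≢ k → f a ≡ + 0) → Σℤ n f ≡ f k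
Σℤ-single zero    z≤n _ = refl
Σℤ-single (suc n) {f} {k} k≤1+n f≡0 with m≤n⇒m<n∨m≡n k≤1+n
... | inj₁ k<1+n = begin
  Σℤ n f + f (suc n)    ≡⟨ cong₂ _+_ (Σℤ-single n (s≤s⁻¹ k<1+n) f≡0) (f≡0 (>⇒≢ k<1+n)) ⟩
  f k + + 0             ≡⟨ +-identityʳ (f k) ⟩
  f k                   ∎
  where open ≡-Reasoning
... | inj₂ refl = begin
  Σℤ n f + f (suc n)    ≡⟨ cong (_+ f (suc n)) (Σℤ-zero n (λ a≤n → f≡0 (<⇒≢ (s≤s a≤n)))) ⟩
  + 0 + f (suc n)       ≡⟨ +-identityˡ (f (suc n)) ⟩
  f (suc n)             ∎
  where open ≡-Reasoning

Σℤ-+ : ∀ n (f g : ℕ → ℤ) → Σℤ n (λ a → f a + g a) ≡ Σℤ n f + Σℤ n g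
Σℤ-+ zero    f g = refl
Σℤ-+ (suc n) f g = trans (cong (_+ (f (suc n) + g (suc n))) (Σℤ-+ n f g))
                         (interchange (Σℤ n f) (Σℤ n g) (f (suc n)) (g (suc n)))
  where
  interchange : ∀ a b c d → (a + b) + (c + d) ≡ (a + c) + (b + d)
  interchange = solve-∀

≈-isEquivalence : IsEquivalence _≈_
≈-isEquivalence = record
  { refl  = λ _ _ → refl
  ; sym   = λ p≈q i j → sym (p≈q i j)
  ; trans = λ p≈q q≈r i j → trans (p≈q i j) (q≈r i j)
  }

Poly-setoid : Setoid 0ℓ 0ℓ
Poly-setoid = record { isEquivalence = ≈-isEquivalence }

open IsEquivalence ≈-isEquivalence using () renaming (refl to ≈-refl; trans to ≈-trans)

infixr 9 x·_ y·_
infixr 8 _·_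

x·_ : Poly → Poly
(x· p) zero    j = + 0
(x· p) (suc i) j = p i j

y·_ : Poly → Poly
(y· p) i zero    = + 0
(y· p) i (suc j) = p i j

_·_ : ℤ → Poly → Poly
(c · p) i j = c * p i j

monomial : ℤ → ℕ → ℕ → Poly
monomial c a b = iter a x·_ (iter b y·_ (const c))

x·-cong : ∀ {p q} → p ≈ q → x· p ≈ x· q
x·-cong p≈q zero    j = refl
x·-cong p≈q (suc i) j = p≈q i j

y·-cong : ∀ {p q} → p ≈ q → y· p ≈ y· q
y·-cong p≈q i zero    = refl
y·-cong p≈q i (suc j) = p≈q i j

·-cong : ∀ c {p q} → p ≈ q → c · p ≈ c · q
·-cong c p≈q i j = cong (c *_) (p≈q i j)

⊕-cong : ∀ {p p′ q q′} → p ≈ p′ → q ≈ q′ → p ⊕ q ≈ p′ ⊕ q′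
⊕-cong p≈p′ q≈q′ i j = cong₂ _+_ (p≈p′ i j) (q≈q′ i j)

⊗-cong : ∀ {p p′ q q′} → p ≈ p′ → q ≈ q′ → p ⊗ q ≈ p′ ⊗ q′
⊗-cong p≈p′ q≈q′ i j =
  Σℤ-cong i λ a → Σℤ-cong j λ b → cong₂ _*_ (p≈p′ a b) (q≈q′ (i ℕ.∸ a) (j ℕ.∸ b))

⊗-distribʳ-⊕ : ∀ p p′ q → (p ⊕ p′) ⊗ q ≈ p ⊗ q ⊕ p′ ⊗ q
⊗-distribʳ-⊕ p p′ q i j = trans
  (Σℤ-cong i λ a → trans (Σℤ-cong j λ b → *-distribʳ-+ _ (p a b) (p′ a b)) (Σℤ-+ j _ _))
  (Σℤ-+ i _ _)

const-⊗ : ∀ c q → const c ⊗ q ≈ c · q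
const-⊗ c q i j = trans (Σℤ-head i λ _ → Σℤ-zero j λ _ → refl) (Σℤ-head j λ _ → refl)

x·-⊗ : ∀ p q → (x· p) ⊗ q ≈ x· (p ⊗ q)
x·-⊗ p q zero    j = Σℤ-zero j λ _ → refl
x·-⊗ p q (suc i) j = begin
  ((x· p) ⊗ q) (suc i) j            ≡⟨ Σℤ-suc i _ ⟩
  Σℤ j (λ _ → + 0) + (p ⊗ q) i j    ≡⟨ cong (_+ (p ⊗ q) i j) (Σℤ-zero j λ _ → refl) ⟩
  + 0 + (p ⊗ q) i j                 ≡⟨ +-identityˡ _ ⟩
  (p ⊗ q) i j                       ∎
  where open ≡-Reasoning

y·-⊗ : ∀ p q → (y· p) ⊗ q ≈ y· (p ⊗ q)
y·-⊗ p q i zero    = Σℤ-zero i λ _ → refl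
y·-⊗ p q i (suc j) = Σℤ-cong i λ a → trans (Σℤ-suc j _) (+-identityˡ _)

·-x· : ∀ c p → c · x· p ≈ x· (c · p)
·-x· c p zero    j = *-zeroʳ c
·-x· c p (suc i) j = refl

·-y· : ∀ c p → c · y· p ≈ y· (c · p)
·-y· c p i zero    = *-zeroʳ c
·-y· c p i (suc j) = refl

·-identityˡ : ∀ p → (+ 1) · p ≈ p
·-identityˡ p i j = *-identityˡ (p i j)

·-distribˡ-⊕ : ∀ c p q → c · (p ⊕ q) ≈ c · p ⊕ c · q
·-distribˡ-⊕ c p q i j = *-distribˡ-+ c (p i j) (q i j)

iter-cong : ∀ {f : Poly → Poly} → (∀ {p q} → p ≈ q → f p ≈ f q) →
            ∀ n {p q} → p ≈ q → iter n f p ≈ iter n f q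
iter-cong f-cong zero    p≈q = p≈q
iter-cong f-cong (suc n) p≈q = f-cong (iter-cong f-cong n p≈q)

monomial-⊗ : ∀ c a b q → monomial c a b ⊗ q ≈ c · iter a x·_ (iter b y·_ q)
monomial-⊗ c zero zero q = const-⊗ c q
monomial-⊗ c zero (suc b) q = begin
  (y· monomial c 0 b) ⊗ q      ≈⟨ y·-⊗ (monomial c 0 b) q ⟩
  y· (monomial c 0 b ⊗ q)      ≈⟨ y·-cong (monomial-⊗ c 0 b q) ⟩
  y· (c · iter b y·_ q)        ≈⟨ ·-y· c _ ⟨
  c · y· iter b y·_ q          ∎
  where open SetoidReasoning Poly-setoid
monomial-⊗ c (suc a) b q = begin
  (x· monomial c a b) ⊗ q                ≈⟨ x·-⊗ (monomial c a b) q ⟩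
  x· (monomial c a b ⊗ q)                ≈⟨ x·-cong (monomial-⊗ c a b q) ⟩
  x· (c · iter a x·_ (iter b y·_ q))     ≈⟨ ·-x· c _ ⟨
  c · x· iter a x·_ (iter b y·_ q)       ∎
  where open SetoidReasoning Poly-setoid

·-monomial : ∀ c a b → c · monomial (+ 1) a b ≈ monomial c a b
·-monomial c zero    zero    zero    zero    = *-identityʳ c
·-monomial c zero    zero    zero    (suc j) = *-zeroʳ c
·-monomial c zero    zero    (suc i) j       = *-zeroʳ c
·-monomial c zero    (suc b) = ≈-trans (·-y· c _) (y·-cong (·-monomial c 0 b))
·-monomial c (suc a) b       = ≈-trans (·-x· c _) (x·-cong (·-monomial c a b))

⊕-monomial-zero : ∀ p a b → p ≈ p ⊕ monomial (+ 0) a b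
⊕-monomial-zero p a b i j =
  sym (trans (cong (_+_ (p i j)) (sym (·-monomial (+ 0) a b i j))) (+-identityʳ (p i j)))

X≈monomial : X ≈ monomial (+ 1) 1 0
X≈monomial zero          j       = refl
X≈monomial (suc zero)    zero    = refl
X≈monomial (suc zero)    (suc j) = refl
X≈monomial (suc (suc i)) j       = refl

Y≈monomial : Y ≈ monomial (+ 1) 0 1
Y≈monomial zero    zero          = refl
Y≈monomial zero    (suc zero)    = refl
Y≈monomial zero    (suc (suc j)) = refl
Y≈monomial (suc i) zero          = refl
Y≈monomial (suc i) (suc zero)    = refl
Y≈monomial (suc i) (suc (suc j)) = refl

X-⊗ : ∀ q → X ⊗ q ≈ x· q
X-⊗ q = begin
  X ⊗ q                     ≈⟨ ⊗-cong X≈monomial (≈-refl {q}) ⟩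
  monomial (+ 1) 1 0 ⊗ q    ≈⟨ monomial-⊗ (+ 1) 1 0 q ⟩
  (+ 1) · x· q              ≈⟨ ·-x· (+ 1) q ⟩
  x· ((+ 1) · q)            ≈⟨ x·-cong (·-identityˡ q) ⟩
  x· q                      ∎
  where open SetoidReasoning Poly-setoid

Y-⊗ : ∀ q → Y ⊗ q ≈ y· q
Y-⊗ q = begin
  Y ⊗ q                     ≈⟨ ⊗-cong Y≈monomial (≈-refl {q}) ⟩
  monomial (+ 1) 0 1 ⊗ q    ≈⟨ monomial-⊗ (+ 1) 0 1 q ⟩
  (+ 1) · y· q              ≈⟨ ·-y· (+ 1) q ⟩
  y· ((+ 1) · q)            ≈⟨ y·-cong (·-identityˡ q) ⟩
  y· q                      ∎
  where open SetoidReasoning Poly-setoid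

Y^≈monomial : ∀ k → Y ^ᵖ k ≈ monomial (+ 1) 0 k
Y^≈monomial zero    = λ _ _ → refl
Y^≈monomial (suc k) = ≈-trans (Y-⊗ (Y ^ᵖ k)) (y·-cong (Y^≈monomial k))

const-⊗-monomial : ∀ c a b → const c ⊗ monomial (+ 1) a b ≈ monomial c a b
const-⊗-monomial c a b = ≈-trans (const-⊗ c _) (·-monomial c a b)

monomial-⊗-Y : ∀ c a → monomial c a 0 ⊗ Y ≈ monomial c a 1
monomial-⊗-Y c a = ≈-trans (monomial-⊗ c a 0 Y)
  (≈-trans (·-cong c (iter-cong x·-cong a Y≈monomial)) (·-monomial c a 1))

const-⊗-X : ∀ c → const c ⊗ X ≈ monomial c 1 0
const-⊗-X c = ≈-trans (⊗-cong (≈-refl {const c}) X≈monomial) (const-⊗-monomial c 1 0)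

X-⊗-Y : X ⊗ Y ≈ monomial (+ 1) 1 1
X-⊗-Y = ≈-trans (⊗-cong X≈monomial (≈-refl {Y})) (monomial-⊗-Y (+ 1) 1)

const-⊗-X-⊗-Y : ∀ c → const c ⊗ X ⊗ Y ≈ monomial c 1 1
const-⊗-X-⊗-Y c = ≈-trans (⊗-cong (const-⊗-X c) (≈-refl {Y})) (monomial-⊗-Y c 1)

const-⊗-Y : ∀ c → const c ⊗ Y ≈ monomial c 0 1
const-⊗-Y c = ≈-trans (⊗-cong (≈-refl {const c}) Y≈monomial) (const-⊗-monomial c 0 1)

const-⊗-Y^ : ∀ c k → const c ⊗ Y ^ᵖ k ≈ monomial c 0 k
const-⊗-Y^ c k = ≈-trans (⊗-cong (≈-refl {const c}) (Y^≈monomial k)) (const-⊗-monomial c 0 k)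

const-⊗-Y⊕Y² : ∀ c → const c ⊗ (Y ⊕ Y ^ᵖ 2) ≈ monomial c 0 1 ⊕ monomial c 0 2
const-⊗-Y⊕Y² c = begin
  const c ⊗ (Y ⊕ Y ^ᵖ 2)                            ≈⟨ const-⊗ c (Y ⊕ Y ^ᵖ 2) ⟩
  c · (Y ⊕ Y ^ᵖ 2)                                  ≈⟨ ·-distribˡ-⊕ c Y (Y ^ᵖ 2) ⟩
  c · Y ⊕ c · Y ^ᵖ 2                                ≈⟨ ⊕-cong (·-cong c Y≈monomial) (·-cong c (Y^≈monomial 2)) ⟩
  c · monomial (+ 1) 0 1 ⊕ c · monomial (+ 1) 0 2   ≈⟨ ⊕-cong (·-monomial c 0 1) (·-monomial c 0 2) ⟩
  monomial c 0 1 ⊕ monomial c 0 2                   ∎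
  where open SetoidReasoning Poly-setoid

ySeries : (ℕ → ℤ) → Poly
ySeries c zero    j = c j
ySeries c (suc i) j = + 0

infixr 9 y·ˢ_

y·ˢ_ : (ℕ → ℤ) → ℕ → ℤ
(y·ˢ c) zero    = + 0
(y·ˢ c) (suc k) = c k

∂ˢ : (ℕ → ℤ) → ℕ → ℤ
∂ˢ c k = + suc k * c (suc k)

ySeries-cong : ∀ {c d} → (∀ k → c k ≡ d k) → ySeries c ≈ ySeries d
ySeries-cong c≗d zero    j = c≗d j
ySeries-cong c≗d (suc i) j = refl

∂x-x·ySeries : ∀ c → ∂x (x· ySeries c) ≈ ySeries c
∂x-x·ySeries c zero    j = *-identityˡ (c j)
∂x-x·ySeries c (suc i) j = *-zeroʳ (+ suc (suc i))

∂y-x·ySeries : ∀ c → ∂y (x· ySeries c) ≈ x· ySeries (∂ˢ c)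
∂y-x·ySeries c zero          j = *-zeroʳ (+ suc j)
∂y-x·ySeries c (suc zero)    j = refl
∂y-x·ySeries c (suc (suc i)) j = *-zeroʳ (+ suc j)

y·-x· : ∀ p → y· x· p ≈ x· y· p
y·-x· p zero    zero    = refl
y·-x· p zero    (suc j) = refl
y·-x· p (suc i) zero    = refl
y·-x· p (suc i) (suc j) = refl

y·-ySeries : ∀ c → y· ySeries c ≈ ySeries (y·ˢ c)
y·-ySeries c zero    zero    = refl
y·-ySeries c zero    (suc j) = refl
y·-ySeries c (suc i) zero    = refl
y·-ySeries c (suc i) (suc j) = refl

·-x·ySeries : ∀ a c → a · x· ySeries c ≈ x· ySeries (λ k → a * c k)
·-x·ySeries a c zero          j = *-zeroʳ a
·-x·ySeries a c (suc zero)    j = refl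
·-x·ySeries a c (suc (suc i)) j = *-zeroʳ a

x·ySeries-⊕ : ∀ c d → x· ySeries c ⊕ x· ySeries d ≈ x· ySeries (λ k → c k + d k)
x·ySeries-⊕ c d zero          j = refl
x·ySeries-⊕ c d (suc zero)    j = refl
x·ySeries-⊕ c d (suc (suc i)) j = refl

gramStep : ℤ → ℤ → ℤ → ℤ → (ℕ → ℤ) → ℕ → ℤ
gramStep a e g t c k = (a * c k + e * (y·ˢ c) k) + (g * (y·ˢ ∂ˢ c) k + t * (y·ˢ y·ˢ ∂ˢ c) k)

gramD-cong : ∀ F G {p q} → p ≈ q → gramD F G p ≈ gramD F G q
gramD-cong F G p≈q = ⊕-cong
  (⊗-cong (≈-refl {F}) λ i j → cong (_*_ (+ suc i)) (p≈q (suc i) j))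
  (⊗-cong (≈-refl {G}) λ i j → cong (_*_ (+ suc j)) (p≈q i (suc j)))

gramD-x·ySeries : ∀ {F G} a e g t →
  F ≈ monomial a 1 0 ⊕ monomial e 1 1 → G ≈ monomial g 0 1 ⊕ monomial t 0 2 →
  ∀ c → gramD F G (x· ySeries c) ≈ x· ySeries (gramStep a e g t c)
gramD-x·ySeries {F} {G} a e g t F≈ G≈ c = begin
  F ⊗ ∂x (x· ySeries c) ⊕ G ⊗ ∂y (x· ySeries c)
    ≈⟨ ⊕-cong (⊗-cong F≈ (∂x-x·ySeries c)) (⊗-cong G≈ (∂y-x·ySeries c)) ⟩
  (monomial a 1 0 ⊕ monomial e 1 1) ⊗ ySeries c ⊕ (monomial g 0 1 ⊕ monomial t 0 2) ⊗ x· ySeries c′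
    ≈⟨ ⊕-cong (⊗-distribʳ-⊕ (monomial a 1 0) (monomial e 1 1) (ySeries c))
              (⊗-distribʳ-⊕ (monomial g 0 1) (monomial t 0 2) (x· ySeries c′)) ⟩
  (monomial a 1 0 ⊗ ySeries c ⊕ monomial e 1 1 ⊗ ySeries c)
    ⊕ (monomial g 0 1 ⊗ x· ySeries c′ ⊕ monomial t 0 2 ⊗ x· ySeries c′)
    ≈⟨ ⊕-cong (⊕-cong (monomial-⊗ a 1 0 (ySeries c)) (monomial-⊗ e 1 1 (ySeries c)))
              (⊕-cong (monomial-⊗ g 0 1 (x· ySeries c′)) (monomial-⊗ t 0 2 (x· ySeries c′))) ⟩
  (a · x· ySeries c ⊕ e · x· y· ySeries c) ⊕ (g · y· x· ySeries c′ ⊕ t · y· y· x· ySeries c′)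
    ≈⟨ ⊕-cong (⊕-cong (≈-refl {a · x· ySeries c}) (·-cong e (x·-cong (y·-ySeries c))))
              (⊕-cong (·-cong g y·x·ySeries) (·-cong t y·y·x·ySeries)) ⟩
  (a · x· ySeries c ⊕ e · x· ySeries (y·ˢ c)) ⊕ (g · x· ySeries (y·ˢ c′) ⊕ t · x· ySeries (y·ˢ y·ˢ c′))
    ≈⟨ ⊕-cong (⊕-cong (·-x·ySeries a c) (·-x·ySeries e (y·ˢ c)))
              (⊕-cong (·-x·ySeries g (y·ˢ c′)) (·-x·ySeries t (y·ˢ y·ˢ c′))) ⟩
  (x· ySeries (λ k → a * c k) ⊕ x· ySeries (λ k → e * (y·ˢ c) k))
    ⊕ (x· ySeries (λ k → g * (y·ˢ c′) k) ⊕ x· ySeries (λ k → t * (y·ˢ y·ˢ c′) k))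
    ≈⟨ ⊕-cong (x·ySeries-⊕ _ _) (x·ySeries-⊕ _ _) ⟩
  x· ySeries (λ k → a * c k + e * (y·ˢ c) k) ⊕ x· ySeries (λ k → g * (y·ˢ c′) k + t * (y·ˢ y·ˢ c′) k)
    ≈⟨ x·ySeries-⊕ _ _ ⟩
  x· ySeries (gramStep a e g t c)
    ∎
  where
  open SetoidReasoning Poly-setoid
  c′ : ℕ → ℤ
  c′ = ∂ˢ c
  y·x·ySeries : y· x· ySeries c′ ≈ x· ySeries (y·ˢ c′)
  y·x·ySeries = ≈-trans (y·-x· (ySeries c′)) (x·-cong (y·-ySeries c′))
  y·y·x·ySeries : y· y· x· ySeries c′ ≈ x· ySeries (y·ˢ y·ˢ c′)
  y·y·x·ySeries = ≈-trans (y·-cong y·x·ySeries)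
                          (≈-trans (y·-x· (ySeries (y·ˢ c′))) (x·-cong (y·-ySeries (y·ˢ c′))))

triangle : (ℕ → ℤ) → (ℕ → ℤ) → ℕ → ℕ → ℤ
triangle u v zero    zero    = + 1
triangle u v zero    (suc k) = + 0
triangle u v (suc n) zero    = u 0 * triangle u v n 0
triangle u v (suc n) (suc k) = u (suc k) * triangle u v n (suc k) + v k * triangle u v n k

triangle-vanish : ∀ u v {n k} → n < k → triangle u v n k ≡ + 0
triangle-vanish u v {zero}  {suc k} _         = refl
triangle-vanish u v {suc n} {suc k} (s≤s n<k) = cong₂ _+_
  (trans (cong (_*_ (u (suc k))) (triangle-vanish u v (m<n⇒m<1+n n<k))) (*-zeroʳ (u (suc k))))
  (trans (cong (_*_ (v k)) (triangle-vanish u v n<k)) (*-zeroʳ (v k)))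

triangle-rescale : ∀ u v v′ (w : ℕ → ℤ) → w 0 ≡ + 1 → (∀ k → w (suc k) * v k ≡ v′ k * w k) →
                   ∀ n k → w k * triangle u v n k ≡ triangle u v′ n k
triangle-rescale u v v′ w w₀≡1 w-v zero zero    = cong (_* + 1) w₀≡1
triangle-rescale u v v′ w w₀≡1 w-v zero (suc k) = *-zeroʳ (w (suc k))
triangle-rescale u v v′ w w₀≡1 w-v (suc n) zero = begin
  w 0 * (u 0 * T n 0)       ≡⟨ swap (w 0) (u 0) (T n 0) ⟩
  u 0 * (w 0 * T n 0)       ≡⟨ cong (_*_ (u 0)) (triangle-rescale u v v′ w w₀≡1 w-v n 0) ⟩
  u 0 * T′ n 0              ∎
  where
  open ≡-Reasoning
  T T′ : ℕ → ℕ → ℤ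
  T  = triangle u v
  T′ = triangle u v′
  swap : ∀ x y z → x * (y * z) ≡ y * (x * z)
  swap = solve-∀
triangle-rescale u v v′ w w₀≡1 w-v (suc n) (suc k) = begin
  w (suc k) * (u (suc k) * T n (suc k) + v k * T n k)
    ≡⟨ expand (w (suc k)) (u (suc k)) (v k) (T n (suc k)) (T n k) ⟩
  u (suc k) * (w (suc k) * T n (suc k)) + w (suc k) * v k * T n k
    ≡⟨ cong₂ _+_ (cong (_*_ (u (suc k))) (rescale n (suc k))) (cong (_* T n k) (w-v k)) ⟩
  u (suc k) * T′ n (suc k) + v′ k * w k * T n k
    ≡⟨ cong (_+_ (u (suc k) * T′ n (suc k)))
            (trans (*-assoc (v′ k) (w k) (T n k)) (cong (_*_ (v′ k)) (rescale n k))) ⟩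
  u (suc k) * T′ n (suc k) + v′ k * T′ n k
    ∎
  where
  open ≡-Reasoning
  T T′ : ℕ → ℕ → ℤ
  T  = triangle u v
  T′ = triangle u v′
  rescale : ∀ n k → w k * T n k ≡ T′ n k
  rescale = triangle-rescale u v v′ w w₀≡1 w-v
  expand : ∀ W U V A B → W * (U * A + V * B) ≡ U * (W * A) + W * V * B
  expand = solve-∀

grammarTriangle : ℤ → ℤ → ℤ → ℤ → ℕ → ℕ → ℤ
grammarTriangle a e g t = triangle (λ k → a + g * + k) (λ k → e + t * + k)

gramStep-grammarTriangle : ∀ a e g t n k →
  gramStep a e g t (grammarTriangle a e g t n) k ≡ grammarTriangle a e g t (suc n) k
gramStep-grammarTriangle a e g t n = step
  where
  T : ℕ → ℤ
  T = grammarTriangle a e g t n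
  row₀ : ∀ a e g t x → (a * x + e * + 0) + (g * + 0 + t * + 0) ≡ (a + g * + 0) * x
  row₀ = solve-∀
  recurrence : ∀ a e g t K K′ x y →
    (a * x + e * y) + (g * (K * x) + t * (K′ * y)) ≡ (a + g * K) * x + (e + t * K′) * y
  recurrence = solve-∀
  step : ∀ k → gramStep a e g t T k ≡ grammarTriangle a e g t (suc n) k
  step zero          = row₀ a e g t (T 0)
  step (suc zero)    = recurrence a e g t (+ 1) (+ 0) (T 1) (T 0)
  step (suc (suc k)) = recurrence a e g t (+ suc (suc k)) (+ suc k) (T (suc (suc k))) (T (suc k))

iter-gramD-X≈x·ySeries : ∀ {F G} a e g t →
  F ≈ monomial a 1 0 ⊕ monomial e 1 1 → G ≈ monomial g 0 1 ⊕ monomial t 0 2 →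
  ∀ n → iter n (gramD F G) X ≈ x· ySeries (grammarTriangle a e g t n)
iter-gramD-X≈x·ySeries a e g t F≈ G≈ zero = X≈x·ySeries
  where
  X≈x·ySeries : X ≈ x· ySeries (grammarTriangle a e g t 0)
  X≈x·ySeries zero          j       = refl
  X≈x·ySeries (suc zero)    zero    = refl
  X≈x·ySeries (suc zero)    (suc j) = refl
  X≈x·ySeries (suc (suc i)) j       = refl
iter-gramD-X≈x·ySeries {F} {G} a e g t F≈ G≈ (suc n) = begin
  gramD F G (iter n (gramD F G) X)
    ≈⟨ gramD-cong F G (iter-gramD-X≈x·ySeries a e g t F≈ G≈ n) ⟩
  gramD F G (x· ySeries (grammarTriangle a e g t n))
    ≈⟨ gramD-x·ySeries a e g t F≈ G≈ (grammarTriangle a e g t n) ⟩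
  x· ySeries (gramStep a e g t (grammarTriangle a e g t n))
    ≈⟨ x·-cong (ySeries-cong (gramStep-grammarTriangle a e g t n)) ⟩
  x· ySeries (grammarTriangle a e g t (suc n))
    ∎
  where open SetoidReasoning Poly-setoid

monomial-y-diag : ∀ c k → monomial c 0 k 0 k ≡ c
monomial-y-diag c zero    = refl
monomial-y-diag c (suc k) = monomial-y-diag c k

monomial-y-off : ∀ c {k j} → k ≢ j → monomial c 0 k 0 j ≡ + 0
monomial-y-off c {zero}  {zero}  k≢j = contradiction refl k≢j
monomial-y-off c {zero}  {suc j} k≢j = refl
monomial-y-off c {suc k} {zero}  k≢j = refl
monomial-y-off c {suc k} {suc j} k≢j = monomial-y-off c (k≢j ∘ cong suc)

monomial-y-row : ∀ c k i j → monomial c 0 k (suc i) j ≡ + 0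
monomial-y-row c zero    i j       = refl
monomial-y-row c (suc k) i zero    = refl
monomial-y-row c (suc k) i (suc j) = monomial-y-row c k i j

Σᵖ-pointwise : ∀ n f i j → Σᵖ n f i j ≡ Σℤ n (λ k → f k i j)
Σᵖ-pointwise zero    f i j = refl
Σᵖ-pointwise (suc n) f i j = cong (_+ f (suc n) i j) (Σᵖ-pointwise n f i j)

Σᵖ-cong : ∀ n {f g} → (∀ k → f k ≈ g k) → Σᵖ n f ≈ Σᵖ n g
Σᵖ-cong zero    f≈g = f≈g 0
Σᵖ-cong (suc n) f≈g = ⊕-cong (Σᵖ-cong n f≈g) (f≈g (suc n))

Σᵖ-monomial-y : ∀ n s → (∀ {k} → n < k → s k ≡ + 0) → Σᵖ n (λ k → monomial (s k) 0 k) ≈ ySeries s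
Σᵖ-monomial-y n s s≡0 zero j with j ≤? n
... | yes j≤n = trans (Σᵖ-pointwise n _ 0 j)
                  (trans (Σℤ-single n j≤n (monomial-y-off _)) (monomial-y-diag (s j) j))
... | no  j≰n = trans (Σᵖ-pointwise n _ 0 j)
                  (trans (Σℤ-zero n λ k≤n → monomial-y-off _ (<⇒≢ (≤-<-trans k≤n (≰⇒> j≰n))))
                         (sym (s≡0 (≰⇒> j≰n))))
Σᵖ-monomial-y n s s≡0 (suc i) j =
  trans (Σᵖ-pointwise n _ (suc i) j) (Σℤ-zero n λ {k} _ → monomial-y-row (s k) k i j)

X-⊗-Σᵖ : ∀ n s → (∀ {k} → n < k → s k ≡ + 0) →
         X ⊗ Σᵖ n (λ k → const (s k) ⊗ Y ^ᵖ k) ≈ x· ySeries s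
X-⊗-Σᵖ n s s≡0 = begin
  X ⊗ Σᵖ n (λ k → const (s k) ⊗ Y ^ᵖ k)   ≈⟨ X-⊗ _ ⟩
  x· Σᵖ n (λ k → const (s k) ⊗ Y ^ᵖ k)    ≈⟨ x·-cong (Σᵖ-cong n λ k → const-⊗-Y^ (s k) k) ⟩
  x· Σᵖ n (λ k → monomial (s k) 0 k)      ≈⟨ x·-cong (Σᵖ-monomial-y n s s≡0) ⟩
  x· ySeries s                            ∎
  where open SetoidReasoning Poly-setoid

iter-gramD-X≈X⊗Σᵖ : ∀ {F G} a e g t →
  F ≈ monomial a 1 0 ⊕ monomial e 1 1 → G ≈ monomial g 0 1 ⊕ monomial t 0 2 →
  (s : ℕ → ℕ → ℤ) → (∀ n k → s n k ≡ grammarTriangle a e g t n k) →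
  ∀ n → iter n (gramD F G) X ≈ X ⊗ Σᵖ n (λ k → const (s n k) ⊗ Y ^ᵖ k)
iter-gramD-X≈X⊗Σᵖ {F} {G} a e g t F≈ G≈ s s≡T n = begin
  iter n (gramD F G) X
    ≈⟨ iter-gramD-X≈x·ySeries a e g t F≈ G≈ n ⟩
  x· ySeries (grammarTriangle a e g t n)
    ≈⟨ x·-cong (ySeries-cong (λ k → sym (s≡T n k))) ⟩
  x· ySeries (s n)
    ≈⟨ X-⊗-Σᵖ n (s n) (λ n<k → trans (s≡T n _) (triangle-vanish _ _ n<k)) ⟨
  X ⊗ Σᵖ n (λ k → const (s n k) ⊗ Y ^ᵖ k)
    ∎
  where open SetoidReasoning Poly-setoid

SF≡grammarTriangle : ∀ m n k → SF m n k ≡ grammarTriangle (+ m - + 1) (+ 1) (+ m) (+ 0) n k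
SF≡grammarTriangle m zero    zero    = refl
SF≡grammarTriangle m zero    (suc k) = refl
SF≡grammarTriangle m (suc n) zero    =
  cong₂ _*_ (sym (trans (cong (_+_ (+ m - + 1)) (*-zeroʳ (+ m))) (+-identityʳ (+ m - + 1))))
            (SF≡grammarTriangle m n 0)
SF≡grammarTriangle m (suc n) (suc k) = cong₂ _+_
  (cong₂ _*_ weight (SF≡grammarTriangle m n (suc k)))
  (trans (SF≡grammarTriangle m n k) (sym (*-identityˡ _)))
  where
  weight : + (m ℕ.* (suc k ℕ.+ 1)) - + 1 ≡ (+ m - + 1) + + m * + suc k
  weight = trans (cong (_- + 1) (trans (pos-* m (suc k ℕ.+ 1)) (cong (_*_ (+ m)) (pos-+ (suc k) 1))))
                 (ring (+ m) (+ suc k))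
    where
    ring : ∀ M K → M * (K + + 1) - + 1 ≡ (M - + 1) + M * K
    ring = solve-∀

SFbar≡grammarTriangle : ∀ m n k → SFbar m n k ≡ grammarTriangle (+ m - + 1) (+ m) (+ m) (+ 0) n k
SFbar≡grammarTriangle m n k =
  trans (cong (_*_ (+ (m ℕ.^ k))) (SF≡grammarTriangle m n k))
        (triangle-rescale _ _ _ (λ k → + (m ℕ.^ k)) refl weight n k)
  where
  weight : ∀ k → + (m ℕ.^ suc k) * (+ 1 + + 0 * + k) ≡ (+ m + + 0 * + k) * + (m ℕ.^ k)
  weight k = trans (cong (_* + 1) (pos-* m (m ℕ.^ k))) (ring (+ m) (+ (m ℕ.^ k)))
    where
    ring : ∀ M P → M * P * + 1 ≡ (M + + 0) * P
    ring = solve-∀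

SFtilde≡grammarTriangle : ∀ m n k → SFtilde m n k ≡ grammarTriangle (+ m - + 1) (+ m) (+ m) (+ m) n k
SFtilde≡grammarTriangle m n k =
  trans (cong (_*_ (+ (m ℕ.^ k ℕ.* k !))) (SF≡grammarTriangle m n k))
        (triangle-rescale _ _ _ (λ k → + (m ℕ.^ k ℕ.* k !)) refl weight n k)
  where
  weight : ∀ k → + (m ℕ.^ suc k ℕ.* suc k !) * (+ 1 + + 0 * + k)
                 ≡ (+ m + + m * + k) * + (m ℕ.^ k ℕ.* k !)
  weight k = begin
    + (m ℕ.^ suc k ℕ.* suc k !) * + 1
      ≡⟨ cong (λ x → + x * + 1) (regroup m (m ℕ.^ k) k (k !)) ⟩
    + (m ℕ.* suc k ℕ.* (m ℕ.^ k ℕ.* k !)) * + 1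
      ≡⟨ cong (_* + 1) (trans (pos-* (m ℕ.* suc k) (m ℕ.^ k ℕ.* k !))
                              (cong (_* + (m ℕ.^ k ℕ.* k !)) (pos-* m (suc k)))) ⟩
    + m * + suc k * + (m ℕ.^ k ℕ.* k !) * + 1
      ≡⟨ ring (+ m) (+ k) (+ (m ℕ.^ k ℕ.* k !)) ⟩
    (+ m + + m * + k) * + (m ℕ.^ k ℕ.* k !)
      ∎
    where
    open ≡-Reasoning
    regroup : ∀ m p k f → m ℕ.* p ℕ.* (suc k ℕ.* f) ≡ m ℕ.* suc k ℕ.* (p ℕ.* f)
    regroup = ℕ-Solver.solve-∀
    ring : ∀ M K W → M * (+ 1 + K) * W * + 1 ≡ (M + M * K) * W
    ring = solve-∀

mainTheorem7 : (m n : ℕ) → n ≥ 1 →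
      (iter n (gramD (const (+ m - + 1) ⊗ X ⊕ X ⊗ Y) (const (+ m) ⊗ Y)) X
        ≈ X ⊗ Σᵖ n (λ k → const (SF m n k) ⊗ Y ^ᵖ k))
    × (iter n (gramD (const (+ m - + 1) ⊗ X ⊕ const (+ m) ⊗ X ⊗ Y) (const (+ m) ⊗ Y)) X
        ≈ X ⊗ Σᵖ n (λ k → const (SFbar m n k) ⊗ Y ^ᵖ k))
    × (iter n (gramD (const (+ m - + 1) ⊗ X ⊕ const (+ m) ⊗ X ⊗ Y) (const (+ m) ⊗ (Y ⊕ Y ^ᵖ 2))) X
        ≈ X ⊗ Σᵖ n (λ k → const (SFtilde m n k) ⊗ Y ^ᵖ k))
mainTheorem7 m n _ =
    iter-gramD-X≈X⊗Σᵖ (+ m - + 1) (+ 1) (+ m) (+ 0) Fₐ G₀ (SF m) (SF≡grammarTriangle m) n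
  , iter-gramD-X≈X⊗Σᵖ (+ m - + 1) (+ m) (+ m) (+ 0) F G₀ (SFbar m) (SFbar≡grammarTriangle m) n
  , iter-gramD-X≈X⊗Σᵖ (+ m - + 1) (+ m) (+ m) (+ m) F G (SFtilde m) (SFtilde≡grammarTriangle m) n
  where
  Fₐ : const (+ m - + 1) ⊗ X ⊕ X ⊗ Y ≈ monomial (+ m - + 1) 1 0 ⊕ monomial (+ 1) 1 1
  Fₐ = ⊕-cong (const-⊗-X (+ m - + 1)) X-⊗-Y
  F : const (+ m - + 1) ⊗ X ⊕ const (+ m) ⊗ X ⊗ Y ≈ monomial (+ m - + 1) 1 0 ⊕ monomial (+ m) 1 1
  F = ⊕-cong (const-⊗-X (+ m - + 1)) (const-⊗-X-⊗-Y (+ m))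
  G₀ : const (+ m) ⊗ Y ≈ monomial (+ m) 0 1 ⊕ monomial (+ 0) 0 2
  G₀ = ≈-trans (const-⊗-Y (+ m)) (⊕-monomial-zero (monomial (+ m) 0 1) 0 2)
  G : const (+ m) ⊗ (Y ⊕ Y ^ᵖ 2) ≈ monomial (+ m) 0 1 ⊕ monomial (+ m) 0 2
  G = const-⊗-Y⊕Y² (+ m)
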